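{- Let $\sigma$ be a unifier of two non-trivial, non-ground and distinct one-variable terms $s[x]$ and $t[x]$ (with the same variable $x$). Then $x\sigma$ is a ground strict subterm of $s$ or of $t$.
   Context: A term is ground if it contains no variables, and trivial if it contains no function symbols, i.e. it is a variable. A one-variable term is a term containing at most one variable. $s[x]$ denotes a term whose only possible variable is $x$. -}

module Defs where

open import Data.Nat using (ℕ)
open import Data.Vec using (Vec; []; _∷_)
open import Data.Vec.Membership.Propositional using (_∈_)
open import Data.Vec.Relation.Unary.Any using (Any)
open import Data.Product using (∃)
open import Relation.Binary.PropositionalEquality using (_≡_)
open import Relation.Nullary using (¬_)

record Signature : Set₁ where
  field
    Fun   : Set
    arity : Fun → ℕ
open Signature public

data Term (Σ : Signature) (V : Set) : Set where
  var : V → Term Σ V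
  fun : (f : Fun Σ) → Vec (Term Σ V) (arity Σ f) → Term Σ V

module _ {Σ : Signature} {V : Set} where

  Subst : Set
  Subst = V → Term Σ V

  mutual
    _⟪_⟫ : Term Σ V → Subst → Term Σ V
    var x ⟪ σ ⟫ = σ x
    fun f ts ⟪ σ ⟫ = fun f (substs ts σ)

    substs : ∀ {n} → Vec (Term Σ V) n → Subst → Vec (Term Σ V) n
    substs [] σ = []
    substs (t ∷ ts) σ = (t ⟪ σ ⟫) ∷ substs ts σ

  Unifier : Subst → Term Σ V → Term Σ V → Set
  Unifier σ s t = s ⟪ σ ⟫ ≡ t ⟪ σ ⟫

  data _occursIn_ (x : V) : Term Σ V → Set where
    here : x occursIn var x
    there : ∀ {f ts} → Any (x occursIn_) ts → x occursIn fun f ts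

  Ground : Term Σ V → Set
  Ground t = ∀ x → ¬ (x occursIn t)

  Trivial : Term Σ V → Set
  Trivial t = ∃ λ x → t ≡ var x

  OnlyVar : V → Term Σ V → Set
  OnlyVar x s = ∀ y → y occursIn s → y ≡ x

  data _⊏_ (u : Term Σ V) : Term Σ V → Set where
    imm  : ∀ {f ts} → u ∈ ts → u ⊏ fun f ts
    deep : ∀ {f ts v} → u ⊏ v → v ∈ ts → u ⊏ fun f ts

{-# OPTIONS --safe #-}
module Submission where

open import Defs
open import Data.Empty using (⊥-elim)
open import Data.Nat using (ℕ; suc; _+_; _≤_; _<_; s≤s)
open import Data.Nat.Properties using (≤-trans; <-irrefl; m≤m+n; m≤n+m; m≤n⇒m≤1+n)
open import Data.Product using (_×_; _,_; Σ-syntax; map₂)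
open import Data.Sum using (_⊎_; inj₁; inj₂)
import Data.Sum as Sum
open import Data.Vec using (Vec; []; _∷_)
open import Data.Vec.Membership.Propositional using (_∈_; find)
open import Data.Vec.Properties using (∷-injective)
open import Data.Vec.Relation.Unary.Any using (Any; here; there)
open import Function using (_∘_)
open import Relation.Binary.PropositionalEquality using (_≡_; refl; sym; trans; cong; cong₂; subst)
open import Relation.Nullary using (¬_)

-- Descend simultaneously into s and t. Since sσ = tσ, two non-variable terms
-- met on the way have the same head symbol, so the descent only stops at a
-- position where one side is x and the other a non-variable term w with
-- xσ = wσ; this position is strict because s ≠ t are both non-variables.
-- By the occurs check x does not occur in w, so w is ground (being a
-- subterm of a one-variable term in x) and xσ = wσ = w.

module _ {Σ : Signature} {V : Set} where

  infix 4 _⊑_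

  _⊑_ : Term Σ V → Term Σ V → Set
  u ⊑ w = u ≡ w ⊎ u ⊏ w

  ⊑-∈⇒⊏ : ∀ {u v f} {ts : Vec (Term Σ V) (arity Σ f)} → u ⊑ v → v ∈ ts → u ⊏ fun f ts
  ⊑-∈⇒⊏ (inj₁ refl) v∈ts = imm v∈ts
  ⊑-∈⇒⊏ (inj₂ u⊏v)  v∈ts = deep u⊏v v∈ts

  Any-⊑⇒⊏ : ∀ {u f} {ts : Vec (Term Σ V) (arity Σ f)} → Any (u ⊑_) ts → u ⊏ fun f ts
  Any-⊑⇒⊏ u⊑ts with find u⊑ts
  ... | _ , v∈ts , u⊑v = ⊑-∈⇒⊏ u⊑v v∈ts

  mutual
    size : Term Σ V → ℕ
    size (var _)    = 1
    size (fun f ts) = suc (sizes ts)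

    sizes : ∀ {n} → Vec (Term Σ V) n → ℕ
    sizes []       = 0
    sizes (t ∷ ts) = size t + sizes ts

  ∈⇒size≤sizes : ∀ {n u} {ts : Vec (Term Σ V) n} → u ∈ ts → size u ≤ sizes ts
  ∈⇒size≤sizes {ts = t ∷ ts} (here refl) = m≤m+n (size t) (sizes ts)
  ∈⇒size≤sizes {ts = t ∷ ts} (there u∈ts) = ≤-trans (∈⇒size≤sizes u∈ts) (m≤n+m (sizes ts) (size t))

  ⊏⇒size< : ∀ {u w : Term Σ V} → u ⊏ w → size u < size w
  ⊏⇒size< (imm u∈ts)      = s≤s (∈⇒size≤sizes u∈ts)
  ⊏⇒size< (deep u⊏v v∈ts) = ≤-trans (⊏⇒size< u⊏v) (m≤n⇒m≤1+n (∈⇒size≤sizes v∈ts))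

  ⊏-irrefl : ∀ {u : Term Σ V} → ¬ (u ⊏ u)
  ⊏-irrefl u⊏u = <-irrefl refl (⊏⇒size< u⊏u)

  fun-injective : ∀ {f g} {us : Vec (Term Σ V) (arity Σ f)} {vs : Vec (Term Σ V) (arity Σ g)} →
                  fun f us ≡ fun g vs →
                  Σ[ f≡g ∈ f ≡ g ] subst (λ h → Vec (Term Σ V) (arity Σ h)) f≡g us ≡ vs
  fun-injective refl = refl , refl

  OnlyVars : ∀ {n} → V → Vec (Term Σ V) n → Set
  OnlyVars x ws = ∀ y → Any (y occursIn_) ws → y ≡ x

  module _ (σ : Subst {Σ} {V}) where

    mutual
      subst-ground : (w : Term Σ V) → Ground w → w ⟪ σ ⟫ ≡ w
      subst-ground (var y)    w-ground = ⊥-elim (w-ground y here)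
      subst-ground (fun f ws) w-ground = cong (fun f) (substs-ground ws (λ y → w-ground y ∘ there))

      substs-ground : ∀ {n} (ws : Vec (Term Σ V) n) → (∀ y → ¬ Any (y occursIn_) ws) → substs ws σ ≡ ws
      substs-ground []       _         = refl
      substs-ground (w ∷ ws) ws-ground =
        cong₂ _∷_ (subst-ground w (λ y → ws-ground y ∘ here)) (substs-ground ws (λ y → ws-ground y ∘ there))

    mutual
      occursIn⇒⊑-subst : ∀ {x} {w : Term Σ V} → x occursIn w → σ x ⊑ w ⟪ σ ⟫
      occursIn⇒⊑-subst here            = inj₁ refl
      occursIn⇒⊑-subst x∈w@(there _) = inj₂ (occursIn-fun⇒⊏-subst x∈w)

      occursIn-fun⇒⊏-subst : ∀ {x f} {ws : Vec (Term Σ V) (arity Σ f)} →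
                              x occursIn fun f ws → σ x ⊏ (fun f ws ⟪ σ ⟫)
      occursIn-fun⇒⊏-subst (there x∈ws) = Any-⊑⇒⊏ (occursIn-any⇒⊑-substs x∈ws)

      occursIn-any⇒⊑-substs : ∀ {x n} {ws : Vec (Term Σ V) n} →
                               Any (x occursIn_) ws → Any (σ x ⊑_) (substs ws σ)
      occursIn-any⇒⊑-substs {ws = _ ∷ _} (here x∈w)   = here (occursIn⇒⊑-subst x∈w)
      occursIn-any⇒⊑-substs {ws = _ ∷ _} (there x∈ws) = there (occursIn-any⇒⊑-substs x∈ws)

    module _ (x : V) where

      OnlyVar-solution⇒Ground : ∀ {f} {ws : Vec (Term Σ V) (arity Σ f)} →
                                 OnlyVar x (fun f ws) → σ x ≡ fun f ws ⟪ σ ⟫ → Ground (fun f ws)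
      OnlyVar-solution⇒Ground x-only σx≡wσ y y∈w with x-only y y∈w
      ... | refl = ⊏-irrefl (subst (σ x ⊏_) (sym σx≡wσ) (occursIn-fun⇒⊏-subst y∈w))

      OnlyVar-solution : ∀ {f} {ws : Vec (Term Σ V) (arity Σ f)} →
                         OnlyVar x (fun f ws) → σ x ≡ fun f ws ⟪ σ ⟫ → Ground (σ x) × σ x ≡ fun f ws
      OnlyVar-solution {f} {ws} x-only σx≡wσ = subst Ground (sym σx≡w) w-ground , σx≡w
        where
        w-ground : Ground (fun f ws)
        w-ground = OnlyVar-solution⇒Ground x-only σx≡wσ

        σx≡w : σ x ≡ fun f ws
        σx≡w = trans σx≡wσ (subst-ground (fun f ws) w-ground)

      GroundBelow : {A : Set} → (Term Σ V → A → Set) → A → A → Set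
      GroundBelow _R_ a b = Ground (σ x) × (σ x R a ⊎ σ x R b)

      mutual
        disagreement : (u v : Term Σ V) → OnlyVar x u → OnlyVar x v →
                       u ⟪ σ ⟫ ≡ v ⟪ σ ⟫ → u ≡ v ⊎ GroundBelow _⊑_ u v
        disagreement (var y) (var z) x-only-u x-only-v _ with x-only-u y here | x-only-v z here
        ... | refl | refl = inj₁ refl
        disagreement (var y) (fun g vs) x-only-u x-only-v eq with x-only-u y here
        ... | refl = inj₂ (map₂ (inj₂ ∘ inj₁) (OnlyVar-solution x-only-v eq))
        disagreement (fun f us) (var z) x-only-u x-only-v eq with x-only-v z here
        ... | refl = inj₂ (map₂ (inj₁ ∘ inj₁) (OnlyVar-solution x-only-u (sym eq)))
        disagreement (fun f us) (fun g vs) x-only-u x-only-v eq =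
          Sum.map₂ (map₂ (Sum.map inj₂ inj₂)) (disagreement-fun x-only-u x-only-v eq)

        disagreement-fun : ∀ {f g} {us : Vec (Term Σ V) (arity Σ f)} {vs : Vec (Term Σ V) (arity Σ g)} →
                           OnlyVar x (fun f us) → OnlyVar x (fun g vs) → fun f us ⟪ σ ⟫ ≡ fun g vs ⟪ σ ⟫ →
                           fun f us ≡ fun g vs ⊎ GroundBelow _⊏_ (fun f us) (fun g vs)
        disagreement-fun {us = us} {vs} x-only-u x-only-v eq with fun-injective eq
        ... | refl , eqs =
          Sum.map (cong (fun _)) (map₂ (Sum.map Any-⊑⇒⊏ Any-⊑⇒⊏))
            (disagreements us vs (λ y → x-only-u y ∘ there) (λ y → x-only-v y ∘ there) eqs)

        disagreements : ∀ {n} (us vs : Vec (Term Σ V) n) → OnlyVars x us → OnlyVars x vs →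
                        substs us σ ≡ substs vs σ → us ≡ vs ⊎ GroundBelow (λ w → Any (w ⊑_)) us vs
        disagreements []       []       _         _         _  = inj₁ refl
        disagreements (u ∷ us) (v ∷ vs) x-only-us x-only-vs eq with ∷-injective eq
        ... | eq₁ , eqs with disagreement u v (λ y → x-only-us y ∘ here) (λ y → x-only-vs y ∘ here) eq₁
        ... | inj₂ below = inj₂ (map₂ (Sum.map here here) below)
        ... | inj₁ refl =
          Sum.map (cong (u ∷_)) (map₂ (Sum.map there there))
            (disagreements us vs (λ y → x-only-us y ∘ there) (λ y → x-only-vs y ∘ there) eqs)

lemma3 : {Σ : Signature} {V : Set} (x : V) (s t : Term Σ V) (σ : Subst {Σ} {V}) →
    OnlyVar x s → OnlyVar x t →
    ¬ Trivial s → ¬ Trivial t →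
    ¬ Ground s → ¬ Ground t →
    ¬ (s ≡ t) →
    Unifier σ s t →
    Ground (σ x) × ((σ x ⊏ s) ⊎ (σ x ⊏ t))
lemma3 x (var y) _ _ _ _ s-nontrivial _ _ _ _ _ = ⊥-elim (s-nontrivial (y , refl))
lemma3 x (fun _ _) (var z) _ _ _ _ t-nontrivial _ _ _ _ = ⊥-elim (t-nontrivial (z , refl))
lemma3 x (fun _ _) (fun _ _) σ x-only-s x-only-t _ _ _ _ s≢t σ-unifies
  with disagreement-fun σ x x-only-s x-only-t σ-unifies
... | inj₁ s≡t   = ⊥-elim (s≢t s≡t)
... | inj₂ below = below
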